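{- Let $M_1$ be the Turing machine with states $A,B,C$ (plus the halting state $H$), symbols $0,1,2$ ($0$ blank) and transition table $\delta(A,0)=(1,R,B)$, $\delta(A,1)=(2,L,A)$, $\delta(A,2)=(1,L,C)$; $\delta(B,0)=(0,L,A)$, $\delta(B,1)=(2,R,B)$, $\delta(B,2)=(1,L,B)$; $\delta(C,0)=(1,R,H)$, $\delta(C,1)=(1,R,A)$, $\delta(C,2)=(1,R,C)$. For $n\ge 0$ let $C(n) = {}^\omega 0\,(A0)\,2^n\,0^\omega$. Then (a) ${}^\omega 0(A0)0^\omega \vdash(3)\ C(1)$, and, for all integers $k \ge 0$: (b) $C(8k+1) \vdash(112k^2+116k+13)\ C(14k+3)$; (c) $C(8k+2) \vdash(112k^2+144k+38)\ C(14k+7)$; (d) $C(8k+3) \vdash(112k^2+172k+54)\ C(14k+8)$; (e) $C(8k+4) \vdash(112k^2+200k+74)\ C(14k+9)$; (f) $C(8k+5) \vdash(112k^2+228k+97)\ {}^\omega 0\,1\,(H1)\,2^{14k+9}\,0^\omega$; (g) $C(8k+6) \vdash(112k^2+256k+139)\ C(14k+14)$; (h) $C(8k+7) \vdash(112k^2+284k+169)\ C(14k+15)$; (i) $C(8k+8) \vdash(112k^2+312k+203)\ C(14k+16)$.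
   Context: Turing machines here have one tape, infinite in both directions, initially all blank except as specified. $\delta(q,a)=(b,D,q')$ means: in state $q$ reading symbol $a$, the machine writes $b$ on the current cell, moves the head one cell left ($D=L$) or right ($D=R$), and enters state $q'$. When the machine enters the halting state $H$ it stops. A configuration is written ${}^\omega 0\, x\,(S a)\, y\, 0^\omega$, where $x,y$ are finite words: the tape contains the word $xay$ surrounded on both sides by infinitely many $0$'s, the machine is in state $S$, and the head scans the cell containing the displayed symbol $a$. Each digit is one tape symbol; $w^n$ denotes the concatenation of $n$ copies of the word $w$ (an exponent applies to the single preceding symbol unless parentheses are used), $w^0$ is empty. $C_1 \vdash(t)\ C_2$ means that the machine, started in configuration $C_1$, is in configuration $C_2$ after exactly $t$ steps. -}

module Defs where

open import Data.Nat using (ℕ; zero; suc)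
open import Data.List using (List; []; _∷_; _++_; replicate)
open import Data.Maybe using (Maybe; just; nothing; _>>=_)
open import Data.Product using (_×_; _,_)
open import Relation.Binary.PropositionalEquality using (_≡_)

data Sym : Set where
  s0 s1 s2 : Sym

data Dir : Set where
  L R : Dir

data State : Set where
  A B C H : State

δ : State → Sym → Maybe (Sym × Dir × State)
δ A s0 = just (s1 , R , B)
δ A s1 = just (s2 , L , A)
δ A s2 = just (s1 , L , C)
δ B s0 = just (s0 , L , A)
δ B s1 = just (s2 , R , B)
δ B s2 = just (s1 , L , B)
δ C s0 = just (s1 , R , H)
δ C s1 = just (s1 , R , A)
δ C s2 = just (s1 , R , C)
δ H _  = nothing

-- A configuration  ^ω0 x (S a) y 0^ω  is represented as
--   conf S l a r
-- where l is x REVERSED (nearest cell to the head first), a the scanned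
-- symbol and r = y.  Cells beyond the ends of the lists are blank (0).
record Config : Set where
  constructor conf
  field
    state : State
    left  : List Sym
    head  : Sym
    right : List Sym

pop : List Sym → Sym × List Sym
pop []       = s0 , []
pop (x ∷ xs) = x , xs

step : Config → Maybe Config
step (conf q l a r) with δ q a
... | nothing = nothing
... | just (b , L , q') with pop l
...   | (c , l') = just (conf q' l' c (b ∷ r))
step (conf q l a r) | just (b , R , q') with pop r
...   | (c , r') = just (conf q' (b ∷ l) c r')

run : ℕ → Config → Maybe Config
run zero    c = just c
run (suc t) c = step c >>= run t

cell : List Sym → ℕ → Sym
cell []       _       = s0
cell (x ∷ xs) zero    = x
cell (x ∷ xs) (suc i) = cell xs i

_≈C_ : Config → Config → Set
conf q l a r ≈C conf q' l' a' r' =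
  (q ≡ q') × (a ≡ a') × (∀ i → cell l i ≡ cell l' i) × (∀ i → cell r i ≡ cell r' i)

_⊢⟨_⟩_ : Config → ℕ → Config → Set
c₁ ⊢⟨ t ⟩ c₂ = Data.Product.∃ λ c → (run t c₁ ≡ just c) × (c ≈C c₂)

Cn : ℕ → Config
Cn n = conf A [] s0 (replicate n s2)

-- Write n = 2 + 4i + j with j ≤ 3. After 8 steps C(n) becomes ^ω0 (A0) 0 1³ 2^(n-2), and from then on
-- the tape is a block of 1s followed by the remaining 2s. A round first writes a counter 111 to the left
-- of the block; then B repeatedly walks right across the 1s, turns the first 2 into a 1, walks back and
-- uses up one counter cell. Four such bounces (the last one off the blank left end) turn four 2s into
-- seven new 1s, in 8m + 49 steps for a block of m + 1 ones, so i rounds leave 1^(3+7i). The j leftover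
-- 2s are absorbed by j more bounces, leaving 3 - j counter cells. Finally B turns all 1s into 2s running
-- right, and A walks back two cells per 8 steps. At the left end A rebuilds some C(N), except when the
-- block has even length (i even) and the counter is exhausted (j = 3), i.e. n ≡ 5 mod 8, where it halts.
module Submission where

open import Defs
open import Data.Nat using (ℕ; zero; suc; _+_; _*_)
open import Data.Nat.Properties using (+-comm)
open import Data.Nat.Tactic.RingSolver using (solve-∀)
open import Data.List using (List; []; _∷_; _++_; replicate)
open import Data.List.Properties using (++-identityʳ)
open import Data.Maybe using (just; _>>=_)
open import Data.Product using (_×_; _,_; proj₁; proj₂)
open import Relation.Binary.PropositionalEquality

replicate-+ : ∀ {A : Set} m n (x : A) → replicate (m + n) x ≡ replicate m x ++ replicate n x
replicate-+ zero    n x = refl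
replicate-+ (suc m) n x = cong (x ∷_) (replicate-+ m n x)

replicate-+-++ : ∀ {A : Set} m n (x : A) r →
                 replicate (m + n) x ++ r ≡ replicate m x ++ replicate n x ++ r
replicate-+-++ zero    n x r = refl
replicate-+-++ (suc m) n x r = cong (x ∷_) (replicate-+-++ m n x r)

replicate-++-comm : ∀ {A : Set} m n (x : A) r →
                    replicate m x ++ replicate n x ++ r ≡ replicate n x ++ replicate m x ++ r
replicate-++-comm m n x r =
  trans (sym (replicate-+-++ m n x r))
        (trans (cong (λ k → replicate k x ++ r) (+-comm m n)) (replicate-+-++ n m x r))

replicate-++-∷ : ∀ {A : Set} n (x : A) r → replicate n x ++ x ∷ r ≡ x ∷ replicate n x ++ r
replicate-++-∷ n = replicate-++-comm n 1

infix  4 _↝⟨_⟩_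
infixr 5 _⨾_ _≡⨾_
infixl 4 _⨾≡_

record _↝⟨_⟩_ (c : Config) (t : ℕ) (c' : Config) : Set where
  constructor reaches
  field runs : run t c ≡ just c'

run-+ : ∀ s t c {c₂ c₃} → run s c ≡ just c₂ → run t c₂ ≡ just c₃ → run (s + t) c ≡ just c₃
run-+ zero    t c refl q = q
run-+ (suc s) t c p    q with step c
... | just c' = run-+ s t c' p q

_⨾_ : ∀ {s t c₁ c₂ c₃} → c₁ ↝⟨ s ⟩ c₂ → c₂ ↝⟨ t ⟩ c₃ → c₁ ↝⟨ s + t ⟩ c₃
_⨾_ {s} {t} {c₁} (reaches p) (reaches q) = reaches (run-+ s t c₁ p q)

_≡⨾_ : ∀ {t c₁ c₂ c₃} → c₁ ≡ c₂ → c₂ ↝⟨ t ⟩ c₃ → c₁ ↝⟨ t ⟩ c₃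
refl ≡⨾ p = p

_⨾≡_ : ∀ {t c₁ c₂ c₃} → c₁ ↝⟨ t ⟩ c₂ → c₂ ≡ c₃ → c₁ ↝⟨ t ⟩ c₃
p ⨾≡ refl = p

retime : ∀ {s t c₁ c₂} → s ≡ t → c₁ ↝⟨ s ⟩ c₂ → c₁ ↝⟨ t ⟩ c₂
retime refl p = p

step-↝ : ∀ {c c'} → step c ≡ just c' → c ↝⟨ 1 ⟩ c'
step-↝ eq = reaches (cong (_>>= run 0) eq)

stepˡ : ∀ q a {b q'} → δ q a ≡ just (b , L , q') → ∀ l r →
        conf q l a r ↝⟨ 1 ⟩ conf q' (proj₂ (pop l)) (proj₁ (pop l)) (b ∷ r)
stepˡ q a {b} {q'} δqa l r = step-↝ (moves δqa)
  where
  moves : δ q a ≡ just (b , L , q') →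
          step (conf q l a r) ≡ just (conf q' (proj₂ (pop l)) (proj₁ (pop l)) (b ∷ r))
  moves eq rewrite eq = refl

stepʳ : ∀ q a {b q'} → δ q a ≡ just (b , R , q') → ∀ l r →
        conf q l a r ↝⟨ 1 ⟩ conf q' (b ∷ l) (proj₁ (pop r)) (proj₂ (pop r))
stepʳ q a {b} {q'} δqa l r = step-↝ (moves δqa)
  where
  moves : δ q a ≡ just (b , R , q') →
          step (conf q l a r) ≡ just (conf q' (b ∷ l) (proj₁ (pop r)) (proj₂ (pop r)))
  moves eq rewrite eq = refl

sweepˡ : ∀ q a {b} → δ q a ≡ just (b , L , q) → ∀ n l r →
         conf q (replicate n a ++ l) a r ↝⟨ n ⟩ conf q l a (replicate n b ++ r)
sweepˡ q a δqa zero    l r = reaches refl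
sweepˡ q a {b} δqa (suc n) l r =
  stepˡ q a δqa (a ∷ replicate n a ++ l) r ⨾ sweepˡ q a δqa n l (b ∷ r)
    ⨾≡ cong (conf q l a) (replicate-++-∷ n b r)

sweepʳ : ∀ q a {b} → δ q a ≡ just (b , R , q) → ∀ n l r →
         conf q l a (replicate n a ++ r) ↝⟨ n ⟩ conf q (replicate n b ++ l) a r
sweepʳ q a δqa zero    l r = reaches refl
sweepʳ q a {b} δqa (suc n) l r =
  stepʳ q a δqa l (a ∷ replicate n a ++ r) ⨾ sweepʳ q a δqa n (b ∷ l) r
    ⨾≡ cong (λ l' → conf q l' a r) (replicate-++-∷ n b l)

onesThen : ℕ → List Sym → Config
onesThen m t = conf A [] s0 (s0 ∷ replicate m s1 ++ t)

C-start : ∀ n → Cn (2 + n) ↝⟨ 8 ⟩ onesThen 3 (replicate n s2)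
C-start n = reaches refl

bounce : ∀ q l r →
         conf B l s1 (replicate q s1 ++ s2 ∷ r)
           ↝⟨ 2 * q + 3 ⟩ conf B (proj₂ (pop l)) (proj₁ (pop l)) (replicate (2 + q) s1 ++ r)
bounce q l r = retime (time q)
  (sweepʳ B s1 refl q l (s2 ∷ r) ⨾ stepʳ B s1 refl (replicate q s2 ++ l) (s2 ∷ r) ⨾
   stepˡ B s2 refl (s2 ∷ replicate q s2 ++ l) r ⨾ sweepˡ B s2 refl q l (s1 ∷ r) ⨾
   stepˡ B s2 refl l (replicate q s1 ++ s1 ∷ r)
     ⨾≡ cong (λ r' → conf B _ _ (s1 ∷ r')) (replicate-++-∷ q s1 r))
  where
  time : ∀ q → q + (1 + (1 + (q + 1))) ≡ 2 * q + 3
  time = solve-∀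

bounces : ∀ j q l r →
          conf B (replicate j s1 ++ l) s1 (replicate q s1 ++ replicate j s2 ++ r)
            ↝⟨ j * (2 * q + 1) + 2 * j * j ⟩ conf B l s1 (replicate (j * 2 + q) s1 ++ r)
bounces zero    q l r = reaches refl
bounces (suc j) q l r = retime (time j q)
  (bounce q (s1 ∷ replicate j s1 ++ l) (replicate j s2 ++ r) ⨾ bounces j (2 + q) l r
     ⨾≡ cong (λ n → conf B l s1 (replicate n s1 ++ r)) (count j q))
  where
  time : ∀ j q → 2 * q + 3 + (j * (2 * (2 + q) + 1) + 2 * j * j)
               ≡ (1 + j) * (2 * q + 1) + 2 * (1 + j) * (1 + j)
  time = solve-∀
  count : ∀ j q → j * 2 + (2 + q) ≡ 2 + (j * 2 + q)
  count = solve-∀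

round-start : ∀ m t → onesThen (suc m) t ↝⟨ 12 ⟩ conf B (replicate 3 s1) s1 (replicate m s1 ++ t)
round-start m t = reaches refl

round : ∀ m t → onesThen (suc m) (replicate 4 s2 ++ t) ↝⟨ 8 * m + 49 ⟩ onesThen (8 + m) t
round m t = retime (time m)
  (round-start m (replicate 4 s2 ++ t) ⨾ bounces 3 m [] (s2 ∷ t) ⨾ bounce (6 + m) [] t ⨾
   stepˡ B s0 refl [] (replicate (8 + m) s1 ++ t))
  where
  time : ∀ m → 12 + ((3 * (2 * m + 1) + 2 * 3 * 3) + ((2 * (6 + m) + 3) + 1)) ≡ 8 * m + 49
  time = solve-∀

rounds : ∀ i m t →
         onesThen (suc m) (replicate (i * 4) s2 ++ t)
           ↝⟨ i * (8 * m + 21) + 28 * i * i ⟩ onesThen (suc (i * 7 + m)) t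
rounds zero    m t = reaches refl
rounds (suc i) m t = retime (time i m)
  (round m (replicate (i * 4) s2 ++ t) ⨾ rounds i (7 + m) t
     ⨾≡ cong (λ n → onesThen (suc n) t) (count i m))
  where
  time : ∀ i m → 8 * m + 49 + (i * (8 * (7 + m) + 21) + 28 * i * i)
               ≡ (1 + i) * (8 * m + 21) + 28 * (1 + i) * (1 + i)
  time = solve-∀
  count : ∀ i m → i * 7 + (7 + m) ≡ (1 + i) * 7 + m
  count = solve-∀

rounds-and-bounces :
  ∀ i j c → j + c ≡ 3 →
  Cn (2 + (i * 4 + j)) ↝⟨ 20 + 37 * i + 28 * i * i + (14 * i + 5) * j + 2 * j * j ⟩
    conf B (replicate c s1) s1 (replicate (j * 2 + (i * 7 + 2)) s1 ++ [])
rounds-and-bounces i j c j+c≡3 = retime (time i j)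
  (C-start (i * 4 + j) ⨾ cong (onesThen 3) (replicate-+ (i * 4) j s2)
   ≡⨾ rounds i 2 (replicate j s2) ⨾ round-start (i * 7 + 2) (replicate j s2)
   ⨾ cong₂ (λ l r → conf B l s1 (replicate (i * 7 + 2) s1 ++ r))
           counter-split (sym (++-identityʳ (replicate j s2)))
   ≡⨾ bounces j (i * 7 + 2) (replicate c s1) [])
  where
  counter-split : replicate 3 s1 ≡ replicate j s1 ++ replicate c s1
  counter-split = trans (cong (λ m → replicate m s1) (sym j+c≡3)) (replicate-+ j c s1)
  time : ∀ i j → 8 + (i * (8 * 2 + 21) + 28 * i * i + (12 + (j * (2 * (i * 7 + 2) + 1) + 2 * j * j)))
               ≡ 20 + 37 * i + 28 * i * i + (14 * i + 5) * j + 2 * j * j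
  time = solve-∀

-- B steps onto the blank right end and back, so the list now ends in an explicit s0; settle discards it.
B-turns-at-end : ∀ l → conf B (s2 ∷ s2 ∷ l) s1 [] ↝⟨ 10 ⟩ conf A l s2 (s2 ∷ s2 ∷ s2 ∷ s0 ∷ [])
B-turns-at-end l = reaches refl

A-crosses-pair : ∀ l r → conf A (s2 ∷ s2 ∷ l) s2 (s2 ∷ r) ↝⟨ 8 ⟩ conf A l s2 (s2 ∷ s2 ∷ s2 ∷ r)
A-crosses-pair l r = reaches refl

A-crosses-pairs : ∀ i l r →
                  conf A (replicate (i * 2) s2 ++ l) s2 (s2 ∷ r)
                    ↝⟨ i * 8 ⟩ conf A l s2 (s2 ∷ replicate (i * 2) s2 ++ r)
A-crosses-pairs zero    l r = reaches refl
A-crosses-pairs (suc i) l r =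
  A-crosses-pair (replicate (i * 2) s2 ++ l) r ⨾ A-crosses-pairs i l (s2 ∷ s2 ∷ r)
    ⨾≡ cong (λ r' → conf A l s2 (s2 ∷ r')) (replicate-++-comm (i * 2) 2 s2 r)

sweep-back : ∀ e z l →
             conf B l s1 (replicate (2 + (z * 2 + e)) s1 ++ [])
               ↝⟨ 12 + z * 10 + e ⟩
             conf A (replicate e s2 ++ l) s2 (s2 ∷ replicate (z * 2 + 2) s2 ++ s0 ∷ [])
sweep-back e z l = retime (time z e)
  (sweepʳ B s1 refl (2 + (z * 2 + e)) l [] ⨾ B-turns-at-end (replicate (z * 2 + e) s2 ++ l)
   ⨾ cong (λ l' → conf A l' s2 (s2 ∷ s2 ∷ s2 ∷ s0 ∷ [])) (replicate-+-++ (z * 2) e s2 l)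
   ≡⨾ A-crosses-pairs z (replicate e s2 ++ l) (s2 ∷ s2 ∷ s0 ∷ [])
     ⨾≡ cong (λ r → conf A _ s2 (s2 ∷ r)) (sym (replicate-+-++ (z * 2) 2 s2 (s0 ∷ []))))
  where
  time : ∀ z e → 2 + (z * 2 + e) + (10 + z * 8) ≡ 12 + z * 10 + e
  time = solve-∀

A-homing : ∀ n r → conf A (replicate n s1) s1 r ↝⟨ suc n ⟩ conf A [] s0 (replicate (suc n) s2 ++ r)
A-homing n r = retime (+-comm n 1)
  (cong (λ l → conf A l s1 r) (sym (++-identityʳ (replicate n s1)))
   ≡⨾ sweepˡ A s1 refl n [] r ⨾ stepˡ A s1 refl [] (replicate n s2 ++ r))

A-meets-one : ∀ c r → conf A (s1 ∷ replicate c s1) s2 (s2 ∷ r) ↝⟨ 3 ⟩ conf A (replicate c s1) s1 (s2 ∷ s2 ∷ r)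
A-meets-one c r = reaches refl

A-meets-two : ∀ c r → conf A (s2 ∷ replicate c s1) s2 (s2 ∷ r) ↝⟨ 6 ⟩ conf A (s1 ∷ replicate c s1) s1 (s2 ∷ r)
A-meets-two c r = reaches refl

A-home-past-ones : ∀ c r →
                   conf A (replicate (suc c) s1) s2 (s2 ∷ r) ↝⟨ 4 + c ⟩ conf A [] s0 (replicate (3 + c) s2 ++ r)
A-home-past-ones c r =
  A-meets-one c r ⨾ A-homing c (s2 ∷ s2 ∷ r)
    ⨾≡ cong (λ r' → conf A [] s0 (s2 ∷ r')) (replicate-++-comm c 2 s2 r)

A-home-past-two : ∀ c r →
                  conf A (s2 ∷ replicate c s1) s2 (s2 ∷ r) ↝⟨ 8 + c ⟩ conf A [] s0 (replicate (3 + c) s2 ++ r)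
A-home-past-two c r =
  A-meets-two c r ⨾ A-homing (suc c) (s2 ∷ r)
    ⨾≡ cong (conf A [] s0) (replicate-++-∷ (2 + c) s2 r)

A-halts-at-end : ∀ r → conf A [] s2 (s2 ∷ r) ↝⟨ 2 ⟩ conf H (s1 ∷ []) s1 (s2 ∷ r)
A-halts-at-end r = reaches refl

cell-++-blank : ∀ xs i → cell (xs ++ s0 ∷ []) i ≡ cell xs i
cell-++-blank []       zero    = refl
cell-++-blank []       (suc i) = refl
cell-++-blank (x ∷ xs) zero    = refl
cell-++-blank (x ∷ xs) (suc i) = cell-++-blank xs i

settle : ∀ {c t q l x} a b {N} → a + b ≡ N →
         c ↝⟨ t ⟩ conf q l x (replicate a s2 ++ replicate b s2 ++ s0 ∷ []) →
         c ⊢⟨ t ⟩ conf q l x (replicate N s2)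
settle a b refl (reaches p) =
  _ , p , refl , refl , (λ _ → refl) ,
  λ i → trans (cong (λ r → cell r i) (sym (replicate-+-++ a b s2 (s0 ∷ []))))
              (cell-++-blank (replicate (a + b) s2) i)

from-C[8k+2+j] :
  ∀ k j c → j + suc c ≡ 3 →
  Cn (8 * k + (2 + j)) ⊢⟨ 112 * k * k + (144 + 28 * j) * k + (36 + 15 * j + 2 * j * j + c) ⟩
    Cn (14 * k + (5 + 2 * j + c))
from-C[8k+2+j] k j c j+c≡3 = settle (3 + c) ((k * 7 + j) * 2 + 2) (size k j c) (retime (time k j c)
  (cong Cn (start k j)
   ≡⨾ rounds-and-bounces (k * 2) j (suc c) j+c≡3
   ⨾ cong (λ p → conf B (replicate (suc c) s1) s1 (replicate p s1 ++ [])) (ones k j)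
   ≡⨾ sweep-back 0 (k * 7 + j) (replicate (suc c) s1)
   ⨾ A-home-past-ones c _))
  where
  start : ∀ k j → 8 * k + (2 + j) ≡ 2 + (k * 2 * 4 + j)
  start = solve-∀
  ones : ∀ k j → j * 2 + (k * 2 * 7 + 2) ≡ 2 + ((k * 7 + j) * 2 + 0)
  ones = solve-∀
  time : ∀ k j c → 20 + 37 * (k * 2) + 28 * (k * 2) * (k * 2) + (14 * (k * 2) + 5) * j + 2 * j * j
                   + (12 + (k * 7 + j) * 10 + 0 + (4 + c))
                 ≡ 112 * k * k + (144 + 28 * j) * k + (36 + 15 * j + 2 * j * j + c)
  time = solve-∀
  size : ∀ k j c → 3 + c + ((k * 7 + j) * 2 + 2) ≡ 14 * k + (5 + 2 * j + c)
  size = solve-∀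

from-C[8k+6+j] :
  ∀ k j c → j + c ≡ 3 →
  Cn (8 * k + (6 + j)) ⊢⟨ 112 * k * k + (256 + 28 * j) * k + (136 + 29 * j + 2 * j * j + c) ⟩
    Cn (14 * k + (11 + 2 * j + c))
from-C[8k+6+j] k j c j+c≡3 = settle (3 + c) ((k * 7 + 3 + j) * 2 + 2) (size k j c) (retime (time k j c)
  (cong Cn (start k j)
   ≡⨾ rounds-and-bounces (k * 2 + 1) j c j+c≡3
   ⨾ cong (λ p → conf B (replicate c s1) s1 (replicate p s1 ++ [])) (ones k j)
   ≡⨾ sweep-back 1 (k * 7 + 3 + j) (replicate c s1)
   ⨾ A-home-past-two c _))
  where
  start : ∀ k j → 8 * k + (6 + j) ≡ 2 + ((k * 2 + 1) * 4 + j)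
  start = solve-∀
  ones : ∀ k j → j * 2 + ((k * 2 + 1) * 7 + 2) ≡ 2 + ((k * 7 + 3 + j) * 2 + 1)
  ones = solve-∀
  time : ∀ k j c → 20 + 37 * (k * 2 + 1) + 28 * (k * 2 + 1) * (k * 2 + 1)
                   + (14 * (k * 2 + 1) + 5) * j + 2 * j * j
                   + (12 + (k * 7 + 3 + j) * 10 + 1 + (8 + c))
                 ≡ 112 * k * k + (256 + 28 * j) * k + (136 + 29 * j + 2 * j * j + c)
  time = solve-∀
  size : ∀ k j c → 3 + c + ((k * 7 + 3 + j) * 2 + 2) ≡ 14 * k + (11 + 2 * j + c)
  size = solve-∀

from-C[8k+5] : ∀ k → Cn (8 * k + 5) ⊢⟨ 112 * k * k + 228 * k + 97 ⟩
                       conf H (s1 ∷ []) s1 (replicate (14 * k + 9) s2)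
from-C[8k+5] k = settle 1 ((k * 7 + 3) * 2 + 2) (size k) (retime (time k)
  (cong Cn (start k)
   ≡⨾ rounds-and-bounces (k * 2) 3 0 refl
   ⨾ cong (λ p → conf B [] s1 (replicate p s1 ++ [])) (ones k)
   ≡⨾ sweep-back 0 (k * 7 + 3) []
   ⨾ A-halts-at-end _))
  where
  start : ∀ k → 8 * k + 5 ≡ 2 + (k * 2 * 4 + 3)
  start = solve-∀
  ones : ∀ k → 3 * 2 + (k * 2 * 7 + 2) ≡ 2 + ((k * 7 + 3) * 2 + 0)
  ones = solve-∀
  time : ∀ k → 20 + 37 * (k * 2) + 28 * (k * 2) * (k * 2) + (14 * (k * 2) + 5) * 3 + 2 * 3 * 3
               + (12 + (k * 7 + 3) * 10 + 0 + 2)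
             ≡ 112 * k * k + 228 * k + 97
  time = solve-∀
  size : ∀ k → 1 + ((k * 7 + 3) * 2 + 2) ≡ 14 * k + 9
  size = solve-∀

blank-run : conf A [] s0 [] ↝⟨ 3 ⟩ conf A [] s0 (s2 ∷ s0 ∷ [])
blank-run = reaches refl

C1-run : Cn 1 ↝⟨ 13 ⟩ conf A [] s0 (s2 ∷ s2 ∷ s2 ∷ s0 ∷ [])
C1-run = reaches refl

from-C[8k+1] : ∀ k → Cn (8 * k + 1) ⊢⟨ 112 * k * k + 116 * k + 13 ⟩ Cn (14 * k + 3)
-- C(1) is too short to start a round; C(8(k+1)+1) is the odd case with j = 3.
from-C[8k+1] zero    = settle 3 0 refl C1-run
from-C[8k+1] (suc k) = cast (start k) (time k) (size k) (from-C[8k+6+j] k 3 0 refl)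
  where
  cast : ∀ {n n' t t' N N'} → n ≡ n' → t ≡ t' → N ≡ N' → Cn n ⊢⟨ t ⟩ Cn N → Cn n' ⊢⟨ t' ⟩ Cn N'
  cast refl refl refl p = p
  start : ∀ k → 8 * k + (6 + 3) ≡ 8 * (1 + k) + 1
  start = solve-∀
  time : ∀ k → 112 * k * k + (256 + 28 * 3) * k + (136 + 29 * 3 + 2 * 3 * 3 + 0)
             ≡ 112 * (1 + k) * (1 + k) + 116 * (1 + k) + 13
  time = solve-∀
  size : ∀ k → 14 * k + (11 + 2 * 3 + 0) ≡ 14 * (1 + k) + 3
  size = solve-∀

theorem3p1 :
    (conf A [] s0 [] ⊢⟨ 3 ⟩ Cn 1)
    × (∀ (k : ℕ) →
        (Cn (8 * k + 1) ⊢⟨ 112 * k * k + 116 * k + 13 ⟩ Cn (14 * k + 3))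
        × (Cn (8 * k + 2) ⊢⟨ 112 * k * k + 144 * k + 38 ⟩ Cn (14 * k + 7))
        × (Cn (8 * k + 3) ⊢⟨ 112 * k * k + 172 * k + 54 ⟩ Cn (14 * k + 8))
        × (Cn (8 * k + 4) ⊢⟨ 112 * k * k + 200 * k + 74 ⟩ Cn (14 * k + 9))
        × (Cn (8 * k + 5) ⊢⟨ 112 * k * k + 228 * k + 97 ⟩
             conf H (s1 ∷ []) s1 (replicate (14 * k + 9) s2))
        × (Cn (8 * k + 6) ⊢⟨ 112 * k * k + 256 * k + 139 ⟩ Cn (14 * k + 14))
        × (Cn (8 * k + 7) ⊢⟨ 112 * k * k + 284 * k + 169 ⟩ Cn (14 * k + 15))
        × (Cn (8 * k + 8) ⊢⟨ 112 * k * k + 312 * k + 203 ⟩ Cn (14 * k + 16)))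
theorem3p1 = settle 1 0 refl blank-run , λ k →
    from-C[8k+1] k
  , from-C[8k+2+j] k 0 2 refl
  , from-C[8k+2+j] k 1 1 refl
  , from-C[8k+2+j] k 2 0 refl
  , from-C[8k+5] k
  , from-C[8k+6+j] k 0 3 refl
  , from-C[8k+6+j] k 1 2 refl
  , from-C[8k+6+j] k 2 1 refl
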